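{- In the MAV-algebra $\mathrm{Chu}(\mathcal N)$ built from the normal-proof frame, with valuation $V(a)=\eta^c(\eta^+(a^\perp))$, every MAV structure $P$ satisfies $[\![P]\!]\sqsubseteq\neg\big(\eta^c(\eta^+(P))\big)$.
   Context: MAV structures $P ::= a \mid a^\perp \mid \mathbf{1} \mid P;Q \mid P\otimes Q \mid P⅋Q \mid P\& Q \mid P\oplus Q$ over a set of atoms, modulo the congruence making $(;,\mathbf 1)$ a monoid and $(\otimes,\mathbf 1),(⅋,\mathbf 1)$ commutative monoids; duality $(a)^\perp=a^\perp$, $(a^\perp)^\perp=a$, $\mathbf 1^\perp=\mathbf 1$, $(P\otimes Q)^\perp=P^\perp⅋Q^\perp$, $(P⅋Q)^\perp=P^\perp\otimes Q^\perp$, $(P;Q)^\perp=P^\perp;Q^\perp$, $(P\&Q)^\perp=P^\perp\oplus Q^\perp$, $(P\oplus Q)^\perp=P^\perp\&Q^\perp$. Normal one-step inference is the least relation closed under one-hole contexts ($P\to Q$ implies $C[P]\to C[Q]$) containing: $a^\perp⅋a\to\mathbf 1$; $(P\otimes Q)⅋R\to P\otimes(Q⅋R)$; $\mathbf 1\&\mathbf 1\to\mathbf 1$; $(P;Q)⅋(R;S)\to(P⅋R);(Q⅋S)$; $P\oplus Q\to P$; $P\oplus Q\to Q$; $(P\&Q)⅋R\to(P⅋R)\&(Q⅋R)$; $(P;Q)\&(R;S)\to(P\&R);(Q\&S)$. Write $P\le Q$ iff there is a normal derivation $P\to^*Q$ (reflexive–transitive closure). Let $\mathcal N$ be the poset quotient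 of this preorder on structures, with operations $⅋$, $;$ (written $\lhd$), unit $\mathbf 1$, and $+:=\&$. Construction: lower sets are subsets $X$ with $Q\in X, P\le Q\Rightarrow P\in X$; $\eta(P)=\{Q\mid Q\le P\}$; $\alpha(X)=\{Q\mid Q\le S$ for some finite $\&$-combination $S$ (any binary bracketing) of elements of $X\}$; $\mathcal C$ is the set of $\&$-closed lower sets; $X\vee Y=\alpha(X\cup Y)$; $\eta^+(P)=\alpha(\eta(P))$; $K=\eta(\mathbf 1)$; $X\circledast Y=\alpha(\{R\mid R\le P⅋Q,P\in X,Q\in Y\})$; $X\hat\lhd Y=\{R\mid R\le P;Q,P\in X,Q\in Y\}$; $X\multimap Y=\{R\mid\forall P\in X,\ R⅋P\in Y\}$. $\mathrm{Chu}(\mathcal N)$: pairs $(X^+,X^-)\in\mathcal C^2$ with $X^+\circledast X^-\subseteq K$, ordered by $X\sqsubseteq Y$ iff $X^+\subseteq Y^+$ and $Y^-\subseteq X^-$; $X\otimes Y=(X^+\circledast Y^+,(Y^+\multimap X^-)\cap(X^+\multimap Y^-))$, $I=(K,K)$, $\neg(X^+,X^-)=(X^-,X^+)$, $X\lhd Y=(X^+\hat\lhd Y^+,X^-\hat\lhd Y^-)$, $X\&Y=(X^+\cap Y^+,X^-\vee Y^-)$; $\eta^c(X)=(X,X\multimap K)$. Interpretation: $[\![\mathbf 1]\!]=I$, $[\![a]\!]=V(a)$, $[\![a^\perp]\!]=\neg V(a)$, $[\![P\otimes Q]\!]=[\![P]\!]\otimes[\![Q]\!]$, $[\![P⅋Q]\!]=\neg(\neg[\![P]\!]\otimes\neg[\![Q]\!])$,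 $[\![P;Q]\!]=[\![P]\!]\lhd[\![Q]\!]$, $[\![P\&Q]\!]=[\![P]\!]\&[\![Q]\!]$, $[\![P\oplus Q]\!]=\neg(\neg[\![P]\!]\&\neg[\![Q]\!])$. -}

module Defs where

open import Level using (0ℓ)
open import Data.Product using (Σ; ∃; ∃-syntax; _×_; _,_)
open import Data.Sum using (_⊎_)
open import Relation.Unary using (Pred; _⊆_; _∪_; _∩_)
open import Relation.Binary.Construct.Closure.ReflexiveTransitive using (Star)

data Struct (A : Set) : Set where
  atom  : A → Struct A
  natom : A → Struct A
  𝟙     : Struct A
  _⨾_   : Struct A → Struct A → Struct A
  _⊗ˢ_  : Struct A → Struct A → Struct A
  _⅋_   : Struct A → Struct A → Struct A
  _&ˢ_  : Struct A → Struct A → Struct A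
  _⊕ˢ_  : Struct A → Struct A → Struct A

infixr 6 _⨾_
infixr 7 _⊗ˢ_ _⅋_ _&ˢ_ _⊕ˢ_

module _ {A : Set} where

  data _≈_ : Struct A → Struct A → Set where
    ≈-refl  : ∀ {P} → P ≈ P
    ≈-sym   : ∀ {P Q} → P ≈ Q → Q ≈ P
    ≈-trans : ∀ {P Q R} → P ≈ Q → Q ≈ R → P ≈ R
    ⨾-cong  : ∀ {P P′ Q Q′} → P ≈ P′ → Q ≈ Q′ → (P ⨾ Q) ≈ (P′ ⨾ Q′)
    ⊗-cong  : ∀ {P P′ Q Q′} → P ≈ P′ → Q ≈ Q′ → (P ⊗ˢ Q) ≈ (P′ ⊗ˢ Q′)
    ⅋-cong  : ∀ {P P′ Q Q′} → P ≈ P′ → Q ≈ Q′ → (P ⅋ Q) ≈ (P′ ⅋ Q′)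
    &-cong  : ∀ {P P′ Q Q′} → P ≈ P′ → Q ≈ Q′ → (P &ˢ Q) ≈ (P′ &ˢ Q′)
    ⊕-cong  : ∀ {P P′ Q Q′} → P ≈ P′ → Q ≈ Q′ → (P ⊕ˢ Q) ≈ (P′ ⊕ˢ Q′)
    ⨾-assoc : ∀ {P Q R} → ((P ⨾ Q) ⨾ R) ≈ (P ⨾ (Q ⨾ R))
    ⨾-unitˡ : ∀ {P} → (𝟙 ⨾ P) ≈ P
    ⨾-unitʳ : ∀ {P} → (P ⨾ 𝟙) ≈ P
    ⊗-assoc : ∀ {P Q R} → ((P ⊗ˢ Q) ⊗ˢ R) ≈ (P ⊗ˢ (Q ⊗ˢ R))
    ⊗-comm  : ∀ {P Q} → (P ⊗ˢ Q) ≈ (Q ⊗ˢ P)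
    ⊗-unitˡ : ∀ {P} → (𝟙 ⊗ˢ P) ≈ P
    ⅋-assoc : ∀ {P Q R} → ((P ⅋ Q) ⅋ R) ≈ (P ⅋ (Q ⅋ R))
    ⅋-comm  : ∀ {P Q} → (P ⅋ Q) ≈ (Q ⅋ P)
    ⅋-unitˡ : ∀ {P} → (𝟙 ⅋ P) ≈ P

  data _⟶_ : Struct A → Struct A → Set where
    atom-int : ∀ {a} → (natom a ⅋ atom a) ⟶ 𝟙
    switch   : ∀ {P Q R} → ((P ⊗ˢ Q) ⅋ R) ⟶ (P ⊗ˢ (Q ⅋ R))
    tidy     : (𝟙 &ˢ 𝟙) ⟶ 𝟙
    seq      : ∀ {P Q R S} → ((P ⨾ Q) ⅋ (R ⨾ S)) ⟶ ((P ⅋ R) ⨾ (Q ⅋ S))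
    left     : ∀ {P Q} → (P ⊕ˢ Q) ⟶ P
    right    : ∀ {P Q} → (P ⊕ˢ Q) ⟶ Q
    external : ∀ {P Q R} → ((P &ˢ Q) ⅋ R) ⟶ ((P ⅋ R) &ˢ (Q ⅋ R))
    medial   : ∀ {P Q R S} → ((P ⨾ Q) &ˢ (R ⨾ S)) ⟶ ((P &ˢ R) ⨾ (Q &ˢ S))
    ⨾ˡ : ∀ {P P′ Q} → P ⟶ P′ → (P ⨾ Q) ⟶ (P′ ⨾ Q)
    ⨾ʳ : ∀ {P Q Q′} → Q ⟶ Q′ → (P ⨾ Q) ⟶ (P ⨾ Q′)
    ⊗ˡ : ∀ {P P′ Q} → P ⟶ P′ → (P ⊗ˢ Q) ⟶ (P′ ⊗ˢ Q)
    ⊗ʳ : ∀ {P Q Q′} → Q ⟶ Q′ → (P ⊗ˢ Q) ⟶ (P ⊗ˢ Q′)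
    ⅋ˡ : ∀ {P P′ Q} → P ⟶ P′ → (P ⅋ Q) ⟶ (P′ ⅋ Q)
    ⅋ʳ : ∀ {P Q Q′} → Q ⟶ Q′ → (P ⅋ Q) ⟶ (P ⅋ Q′)
    &ˡ : ∀ {P P′ Q} → P ⟶ P′ → (P &ˢ Q) ⟶ (P′ &ˢ Q)
    &ʳ : ∀ {P Q Q′} → Q ⟶ Q′ → (P &ˢ Q) ⟶ (P &ˢ Q′)
    ⊕ˡ : ∀ {P P′ Q} → P ⟶ P′ → (P ⊕ˢ Q) ⟶ (P′ ⊕ˢ Q)
    ⊕ʳ : ∀ {P Q Q′} → Q ⟶ Q′ → (P ⊕ˢ Q) ⟶ (P ⊕ˢ Q′)

  _⟶≈_ : Struct A → Struct A → Set
  P ⟶≈ Q = (P ≈ Q) ⊎ (P ⟶ Q)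

  _≤_ : Struct A → Struct A → Set
  P ≤ Q = Star _⟶≈_ P Q

  SSet : Set₁
  SSet = Pred (Struct A) 0ℓ

  η : Struct A → SSet
  η P Q = Q ≤ P

  data WithComb (X : SSet) : Struct A → Set where
    base : ∀ {P} → X P → WithComb X P
    comb : ∀ {S T} → WithComb X S → WithComb X T → WithComb X (S &ˢ T)

  α : SSet → SSet
  α X Q = ∃[ S ] (WithComb X S × Q ≤ S)

  _∨ᶜ_ : SSet → SSet → SSet
  X ∨ᶜ Y = α (X ∪ Y)

  η⁺ : Struct A → SSet
  η⁺ P = α (η P)

  K : SSet
  K = η 𝟙

  _⊛_ : SSet → SSet → SSet
  X ⊛ Y = α (λ R → ∃[ P ] ∃[ Q ] (X P × Y Q × R ≤ (P ⅋ Q)))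

  _◁̂_ : SSet → SSet → SSet
  X ◁̂ Y = λ R → ∃[ P ] ∃[ Q ] (X P × Y Q × R ≤ (P ⨾ Q))

  _⊸_ : SSet → SSet → SSet
  X ⊸ Y = λ R → ∀ P → X P → Y (R ⅋ P)

  -- Elements of Chu(𝒩) are pairs (X⁺ , X⁻); the operations below are
  -- defined on raw pairs of sets.
  ChuPair : Set₁
  ChuPair = SSet × SSet

  _⊑_ : ChuPair → ChuPair → Set
  (X⁺ , X⁻) ⊑ (Y⁺ , Y⁻) = (X⁺ ⊆ Y⁺) × (Y⁻ ⊆ X⁻)

  _⊗ᶜ_ : ChuPair → ChuPair → ChuPair
  (X⁺ , X⁻) ⊗ᶜ (Y⁺ , Y⁻) = (X⁺ ⊛ Y⁺) , ((Y⁺ ⊸ X⁻) ∩ (X⁺ ⊸ Y⁻))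

  Iᶜ : ChuPair
  Iᶜ = K , K

  negᶜ : ChuPair → ChuPair
  negᶜ (X⁺ , X⁻) = X⁻ , X⁺

  _◁ᶜ_ : ChuPair → ChuPair → ChuPair
  (X⁺ , X⁻) ◁ᶜ (Y⁺ , Y⁻) = (X⁺ ◁̂ Y⁺) , (X⁻ ◁̂ Y⁻)

  _&ᶜ_ : ChuPair → ChuPair → ChuPair
  (X⁺ , X⁻) &ᶜ (Y⁺ , Y⁻) = (X⁺ ∩ Y⁺) , (X⁻ ∨ᶜ Y⁻)

  ηᶜ : SSet → ChuPair
  ηᶜ X = X , (X ⊸ K)

  V : A → ChuPair
  V a = ηᶜ (η⁺ (natom a))

  ⟦_⟧ : Struct A → ChuPair
  ⟦ atom a ⟧  = V a
  ⟦ natom a ⟧ = negᶜ (V a)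
  ⟦ 𝟙 ⟧       = Iᶜ
  ⟦ P ⨾ Q ⟧   = ⟦ P ⟧ ◁ᶜ ⟦ Q ⟧
  ⟦ P ⊗ˢ Q ⟧  = ⟦ P ⟧ ⊗ᶜ ⟦ Q ⟧
  ⟦ P ⅋ Q ⟧   = negᶜ (negᶜ ⟦ P ⟧ ⊗ᶜ negᶜ ⟦ Q ⟧)
  ⟦ P &ˢ Q ⟧  = ⟦ P ⟧ &ᶜ ⟦ Q ⟧
  ⟦ P ⊕ˢ Q ⟧  = negᶜ (negᶜ ⟦ P ⟧ &ᶜ negᶜ ⟦ Q ⟧)

{-# OPTIONS --safe #-}
-- Write R ⊥ P for R ⅋ P ≤ 𝟙. By simultaneous induction on P: every element
-- of ⟦ P ⟧⁺ is orthogonal to P, P itself lies in ⟦ P ⟧⁻, and ⟦ P ⟧⁻ is a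
-- &-closed lower set. Since η⁺ P is the least &-closed lower set containing P,
-- it lies inside ⟦ P ⟧⁻ and inside {T ∣ R ⊥ T} for every R ∈ ⟦ P ⟧⁺, which
-- are the two halves of the inequality.
module Submission where

open import Defs
open import Data.Product using (_,_; proj₁; proj₂)
open import Data.Sum using (inj₁; inj₂)
open import Relation.Unary using (_⊆_; _∩_)
open import Relation.Binary.Construct.Closure.ReflexiveTransitive using (ε; _◅_; _◅◅_; gmap)

module _ {A : Set} where

  private
    Str : Set
    Str = Struct A

  ≈⇒≤ : ∀ {P Q : Str} → P ≈ Q → P ≤ Q
  ≈⇒≤ e = inj₁ e ◅ ε

  ⟶⇒≤ : ∀ {P Q : Str} → P ⟶ Q → P ≤ Q
  ⟶⇒≤ r = inj₂ r ◅ ε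

  ≤-context : (C : Str → Str) →
              (∀ {P Q} → P ≈ Q → C P ≈ C Q) → (∀ {P Q} → P ⟶ Q → C P ⟶ C Q) →
              ∀ {P Q} → P ≤ Q → C P ≤ C Q
  ≤-context C ≈-ctx ⟶-ctx = gmap C λ { (inj₁ e) → inj₁ (≈-ctx e) ; (inj₂ r) → inj₂ (⟶-ctx r) }

  ⅋-monoˡ-≤ : ∀ {P P′ Q : Str} → P ≤ P′ → (P ⅋ Q) ≤ (P′ ⅋ Q)
  ⅋-monoˡ-≤ {Q = Q} = ≤-context (_⅋ Q) (λ e → ⅋-cong e ≈-refl) ⅋ˡ

  ⅋-monoʳ-≤ : ∀ {P Q Q′ : Str} → Q ≤ Q′ → (P ⅋ Q) ≤ (P ⅋ Q′)
  ⅋-monoʳ-≤ {P = P} = ≤-context (P ⅋_) (⅋-cong ≈-refl) ⅋ʳ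

  ⊗-monoʳ-≤ : ∀ {P Q Q′ : Str} → Q ≤ Q′ → (P ⊗ˢ Q) ≤ (P ⊗ˢ Q′)
  ⊗-monoʳ-≤ {P = P} = ≤-context (P ⊗ˢ_) (⊗-cong ≈-refl) ⊗ʳ

  ⨾-mono-≤ : ∀ {P P′ Q Q′ : Str} → P ≤ P′ → Q ≤ Q′ → (P ⨾ Q) ≤ (P′ ⨾ Q′)
  ⨾-mono-≤ {P′ = P′} {Q = Q} p q =
    ≤-context (_⨾ Q) (λ e → ⨾-cong e ≈-refl) ⨾ˡ p ◅◅ ≤-context (P′ ⨾_) (⨾-cong ≈-refl) ⨾ʳ q

  &-mono-≤ : ∀ {P P′ Q Q′ : Str} → P ≤ P′ → Q ≤ Q′ → (P &ˢ Q) ≤ (P′ &ˢ Q′)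
  &-mono-≤ {P′ = P′} {Q = Q} p q =
    ≤-context (_&ˢ Q) (λ e → &-cong e ≈-refl) &ˡ p ◅◅ ≤-context (P′ &ˢ_) (&-cong ≈-refl) &ʳ q

  record IsClosed (X : SSet {A}) : Set where
    field
      lower    : ∀ {R T} → R ≤ T → X T → X R
      &-closed : ∀ {R T} → X R → X T → X (R &ˢ T)

  open IsClosed

  α-closed : ∀ {X} → IsClosed (α X)
  α-closed = record
    { lower    = λ { R≤T (S , w , T≤S) → S , w , (R≤T ◅◅ T≤S) }
    ; &-closed = λ { (S , v , R≤S) (S′ , w , T≤S′) → (S &ˢ S′) , comb v w , &-mono-≤ R≤S T≤S′ }
    }

  α-least : ∀ {X Y} → IsClosed Y → X ⊆ Y → α X ⊆ Y
  α-least {X} {Y} Y-closed X⊆Y (S , w , R≤S) = lower Y-closed R≤S (combination w)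
    where
    combination : ∀ {S} → WithComb X S → Y S
    combination (base x)   = X⊆Y x
    combination (comb v w) = &-closed Y-closed (combination v) (combination w)

  η⁺-self : ∀ {P : Str} → η⁺ P P
  η⁺-self {P} = P , base ε , ε

  η⁺-least : ∀ {Y P} → IsClosed Y → Y P → η⁺ P ⊆ Y
  η⁺-least Y-closed YP = α-least Y-closed (λ R≤P → lower Y-closed R≤P YP)

  K-closed : IsClosed K
  K-closed = record
    { lower    = _◅◅_
    ; &-closed = λ R≤𝟙 T≤𝟙 → &-mono-≤ R≤𝟙 T≤𝟙 ◅◅ ⟶⇒≤ tidy
    }

  ⊸-closed : ∀ {X Y} → IsClosed Y → IsClosed (X ⊸ Y)
  ⊸-closed Y-closed = record
    { lower    = λ R≤T h P x → lower Y-closed (⅋-monoˡ-≤ R≤T) (h P x)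
    ; &-closed = λ g h P x → lower Y-closed (⟶⇒≤ external) (&-closed Y-closed (g P x) (h P x))
    }

  ∩-closed : ∀ {X Y} → IsClosed X → IsClosed Y → IsClosed (X ∩ Y)
  ∩-closed X-closed Y-closed = record
    { lower    = λ R≤T (x , y) → lower X-closed R≤T x , lower Y-closed R≤T y
    ; &-closed = λ (x , y) (x′ , y′) → &-closed X-closed x x′ , &-closed Y-closed y y′
    }

  ◁̂-closed : ∀ {X Y} → IsClosed X → IsClosed Y → IsClosed (X ◁̂ Y)
  ◁̂-closed X-closed Y-closed = record
    { lower    = λ { R≤T (P , Q , x , y , T≤PQ) → P , Q , x , y , (R≤T ◅◅ T≤PQ) }
    ; &-closed = λ { (P , Q , x , y , R≤PQ) (P′ , Q′ , x′ , y′ , T≤PQ′) →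
                     (P &ˢ P′) , (Q &ˢ Q′) , &-closed X-closed x x′ , &-closed Y-closed y y′
                   , (&-mono-≤ R≤PQ T≤PQ′ ◅◅ ⟶⇒≤ medial) }
    }

  _⊥_ : Str → Str → Set
  R ⊥ P = (R ⅋ P) ≤ 𝟙

  ⊥-sym : ∀ {R P} → R ⊥ P → P ⊥ R
  ⊥-sym R⊥P = ≈⇒≤ ⅋-comm ◅◅ R⊥P

  ⊥-closedˡ : ∀ {P} → IsClosed (_⊥ P)
  ⊥-closedˡ = record
    { lower    = λ R≤T T⊥P → ⅋-monoˡ-≤ R≤T ◅◅ T⊥P
    ; &-closed = λ R⊥P T⊥P → ⟶⇒≤ external ◅◅ &-closed K-closed R⊥P T⊥P
    }

  ⊥-closedʳ : ∀ {R} → IsClosed (R ⊥_)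
  ⊥-closedʳ = record
    { lower    = λ T≤P R⊥P → ⅋-monoʳ-≤ T≤P ◅◅ R⊥P
    ; &-closed = λ R⊥P R⊥Q → ⊥-sym (&-closed ⊥-closedˡ (⊥-sym R⊥P) (⊥-sym R⊥Q))
    }

  switch-⊥ : ∀ {P Q R} → R ⊥ Q → ((P ⊗ˢ Q) ⅋ R) ≤ P
  switch-⊥ R⊥Q = ⟶⇒≤ switch ◅◅ ⊗-monoʳ-≤ (⊥-sym R⊥Q) ◅◅ ≈⇒≤ (≈-trans ⊗-comm ⊗-unitˡ)

  ⅋-⊥-⊗ : ∀ {P Q P₁ Q₁} → P₁ ⊥ P → Q₁ ⊥ Q → (P₁ ⅋ Q₁) ⊥ (P ⊗ˢ Q)
  ⅋-⊥-⊗ P₁⊥P Q₁⊥Q =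
    -- rearrange to ((Q ⊗ P) ⅋ P₁) ⅋ Q₁, so that switch can consume P₁ ⊥ P
    ≈⇒≤ (≈-trans ⅋-comm (≈-trans (≈-sym ⅋-assoc) (⅋-cong (⅋-cong ⊗-comm ≈-refl) ≈-refl)))
    ◅◅ ⅋-monoˡ-≤ (switch-⊥ P₁⊥P) ◅◅ ⊥-sym Q₁⊥Q

  ⨾-⊥-⨾ : ∀ {P Q P₁ Q₁} → P₁ ⊥ P → Q₁ ⊥ Q → (P₁ ⨾ Q₁) ⊥ (P ⨾ Q)
  ⨾-⊥-⨾ P₁⊥P Q₁⊥Q = ⟶⇒≤ seq ◅◅ ⨾-mono-≤ P₁⊥P Q₁⊥Q ◅◅ ≈⇒≤ ⨾-unitˡ

  ⅋-⊥-assoc : ∀ {R P Q} → (R ⅋ P) ⊥ Q → R ⊥ (P ⅋ Q)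
  ⅋-⊥-assoc RP⊥Q = ≈⇒≤ (≈-sym ⅋-assoc) ◅◅ RP⊥Q

  ⟦_⟧⁺ ⟦_⟧⁻ : Str → SSet
  ⟦ P ⟧⁺ = proj₁ ⟦ P ⟧
  ⟦ P ⟧⁻ = proj₂ ⟦ P ⟧

  ⟦⟧⁻-closed : ∀ P → IsClosed ⟦ P ⟧⁻
  ⟦⟧⁻-closed (atom a)  = ⊸-closed K-closed
  ⟦⟧⁻-closed (natom a) = α-closed
  ⟦⟧⁻-closed 𝟙         = K-closed
  ⟦⟧⁻-closed (P ⨾ Q)   = ◁̂-closed (⟦⟧⁻-closed P) (⟦⟧⁻-closed Q)
  ⟦⟧⁻-closed (P ⊗ˢ Q)  = ∩-closed (⊸-closed (⟦⟧⁻-closed P)) (⊸-closed (⟦⟧⁻-closed Q))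
  ⟦⟧⁻-closed (P ⅋ Q)   = α-closed
  ⟦⟧⁻-closed (P &ˢ Q)  = α-closed
  ⟦⟧⁻-closed (P ⊕ˢ Q)  = ∩-closed (⟦⟧⁻-closed P) (⟦⟧⁻-closed Q)

  mutual
    ⟦⟧⁺⊆⊥ : ∀ P → ⟦ P ⟧⁺ ⊆ (_⊥ P)
    ⟦⟧⁺⊆⊥ (atom a)  = η⁺-least ⊥-closedˡ (⟶⇒≤ atom-int)
    ⟦⟧⁺⊆⊥ (natom a) h = h (natom a) η⁺-self
    ⟦⟧⁺⊆⊥ 𝟙 R≤𝟙 = ⅋-monoˡ-≤ R≤𝟙 ◅◅ ≈⇒≤ ⅋-unitˡ
    ⟦⟧⁺⊆⊥ (P ⨾ Q) (P₁ , Q₁ , p , q , R≤P₁Q₁) =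
      ⅋-monoˡ-≤ R≤P₁Q₁ ◅◅ ⨾-⊥-⨾ (⟦⟧⁺⊆⊥ P p) (⟦⟧⁺⊆⊥ Q q)
    ⟦⟧⁺⊆⊥ (P ⊗ˢ Q) = α-least ⊥-closedˡ λ { (P₁ , Q₁ , p , q , R≤P₁Q₁) →
      ⅋-monoˡ-≤ R≤P₁Q₁ ◅◅ ⅋-⊥-⊗ (⟦⟧⁺⊆⊥ P p) (⟦⟧⁺⊆⊥ Q q) }
    ⟦⟧⁺⊆⊥ (P ⅋ Q) (_ , h) = ⅋-⊥-assoc (⟦⟧⁺⊆⊥ Q (h P (self∈⟦⟧⁻ P)))
    ⟦⟧⁺⊆⊥ (P &ˢ Q) (p , q) = &-closed ⊥-closedʳ (⟦⟧⁺⊆⊥ P p) (⟦⟧⁺⊆⊥ Q q)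
    ⟦⟧⁺⊆⊥ (P ⊕ˢ Q) = α-least ⊥-closedˡ λ
      { (inj₁ p) → lower ⊥-closedʳ (⟶⇒≤ left) (⟦⟧⁺⊆⊥ P p)
      ; (inj₂ q) → lower ⊥-closedʳ (⟶⇒≤ right) (⟦⟧⁺⊆⊥ Q q)
      }

    self∈⟦⟧⁻ : ∀ P → ⟦ P ⟧⁻ P
    self∈⟦⟧⁻ (atom a)  _ t = ⊥-sym (⟦⟧⁺⊆⊥ (atom a) t)
    self∈⟦⟧⁻ (natom a) = η⁺-self
    self∈⟦⟧⁻ 𝟙         = ε
    self∈⟦⟧⁻ (P ⨾ Q)   = P , Q , self∈⟦⟧⁻ P , self∈⟦⟧⁻ Q , ε
    self∈⟦⟧⁻ (P ⊗ˢ Q)  =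
        (λ _ q → lower (⟦⟧⁻-closed P) (switch-⊥ (⟦⟧⁺⊆⊥ Q q)) (self∈⟦⟧⁻ P))
      , (λ _ p → lower (⟦⟧⁻-closed Q) (⅋-monoˡ-≤ (≈⇒≤ ⊗-comm) ◅◅ switch-⊥ (⟦⟧⁺⊆⊥ P p)) (self∈⟦⟧⁻ Q))
    self∈⟦⟧⁻ (P ⅋ Q)   = (P ⅋ Q) , base (P , Q , self∈⟦⟧⁻ P , self∈⟦⟧⁻ Q , ε) , ε
    self∈⟦⟧⁻ (P &ˢ Q)  = (P &ˢ Q) , comb (base (inj₁ (self∈⟦⟧⁻ P))) (base (inj₂ (self∈⟦⟧⁻ Q))) , ε
    self∈⟦⟧⁻ (P ⊕ˢ Q)  =
      lower (⟦⟧⁻-closed P) (⟶⇒≤ left) (self∈⟦⟧⁻ P) , lower (⟦⟧⁻-closed Q) (⟶⇒≤ right) (self∈⟦⟧⁻ Q)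

proposition4p1 : {A : Set} (P : Struct A) → ⟦ P ⟧ ⊑ negᶜ (ηᶜ (η⁺ P))
proposition4p1 P =
    (λ r T t → η⁺-least ⊥-closedʳ (⟦⟧⁺⊆⊥ P r) t)
  , η⁺-least (⟦⟧⁻-closed P) (self∈⟦⟧⁻ P)
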